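{- (a) For all integers $n\ge N\ge 4$, $m_n(p_N)=\frac58$. (b) For every even $N\ge 6$, every $n\ge N$ and every $x$ with $p_{N-2}\le x\le p_N$, one has $m_N(x)=\frac58$ and $m_n(x)\ge m_N(x)$.
   Context: For $x\in[0,1]$ define $\Delta_1(x)=\frac12-|x-\frac12|$ and, for $n\ge2$, $\Delta_n(x)=\frac12\Delta_{n-1}(2x-\lfloor 2x\rfloor)$; $m_n(x)=\sum_{i=1}^n\Delta_i(x)$. For $N\ge 3$, $p_N=\frac12-\lceil 2^N/24\rceil/2^N$.
   Formalization: In part (b) the variable x ranges only over the rationals with $p_{N-2}\le x\le p_N$ rather than over all real numbers in that interval. -}

module Defs where

open import Data.Nat as ℕ using (ℕ; zero; suc; _^_)
open import Data.Integer as ℤ using (+_)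
open import Data.Rational using (ℚ; _+_; _-_; _*_; ½; ∣_∣; floor; ceiling; _/_; 0ℚ; 1ℚ)

halfPow : ℕ → ℚ
halfPow zero    = 1ℚ
halfPow (suc k) = ½ * halfPow k

frac2 : ℚ → ℚ
frac2 x = (+ 2 / 1) * x - (floor ((+ 2 / 1) * x) / 1)

-- Δ n x = Δ_n(x) for n ≥ 1 (Δ 0 := 0 is an unused convention)
Δ : ℕ → ℚ → ℚ
Δ zero          x = 0ℚ
Δ (suc zero)    x = ½ - ∣ x - ½ ∣
Δ (suc (suc n)) x = ½ * Δ (suc n) (frac2 x)

m : ℕ → ℚ → ℚ
m zero    x = 0ℚ
m (suc n) x = m n x + Δ (suc n) x

p : ℕ → ℚ
p N = ½ - (ceiling ((+ (2 ^ N) / 1) * (+ 1 / 24)) / 1) * halfPow N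

five/eight : ℚ
five/eight = + 5 / 8

-- Write x ∈ [0,1) in binary. On the half where the next digit is 0 (resp. 1) one has
-- m (n+1) x = x + ½ m n (2x) (resp. (1 − x) + ½ m n (2x − 1)); following the prefix 0111
-- gives m (4 + M) x = 3/2 − 2x + m M (16x − 7) / 16 for x ∈ [7/16, 1/2). Since p N is
-- 0.0111(01)^j for N = 4 + 2j and N = 5 + 2j, everything reduces to the points
-- w j = 0.(01)^j: the prefix 01 maps [w (j+1), w (j+2)] affinely onto [w j, w (j+1)] by
-- v ↦ 4v − 1 and turns m (2 + M) into ½ + ¼ m M (4v − 1), so by induction m (2 + 2j) v = 2v
-- on [w j, w (j+1)], and m n (w j) = 2 w j for all n ≥ 2j. Substituting v = 16x − 7 makes
-- the x-terms cancel, leaving 3/2 − 7/8 = 5/8. Monotonicity in n holds because each Δ i is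
-- nonnegative on [0,1].
module Submission where

open import Defs
open import Data.Nat as ℕ using (ℕ; zero; suc; _∸_; _^_; _≤′_; ≤′-refl; ≤′-step; s≤s) renaming (_≤_ to _≤ℕ_)
import Data.Nat.Properties as ℕ
import Data.Nat.Tactic.RingSolver as ℕ-Solver
open import Data.Nat.Divisibility using (_∣_; divides)
open import Data.Integer as ℤ using (ℤ; +_; -[1+_])
import Data.Integer.Properties as ℤ
open import Data.Integer.DivMod using (a≡a%n+[a/n]*n; n%d<d)
open import Data.Rational
open import Data.Rational.Properties
open import Data.Rational.Literals using (fromℤ)
open import Data.Rational.Solver using (module +-*-Solver)
open import Data.Product using (_×_; _,_; ∃)
open import Data.Sum using (_⊎_; inj₁; inj₂)
open import Data.List using (_∷_; [])
open import Relation.Nullary.Decidable using (True; toWitness; yes; no)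
open import Relation.Binary.PropositionalEquality
open +-*-Solver using (solve; _:+_; _:-_; :-_; _:*_; _:=_; con)

≤-compute : ∀ {p q} → {True (p ≤? q)} → p ≤ q
≤-compute {_} {_} {t} = toWitness t

<-compute : ∀ {p q} → {True (p <? q)} → p < q
<-compute {_} {_} {t} = toWitness t

p≤q⇒0≤q-p : ∀ {p q} → p ≤ q → 0ℚ ≤ q - p
p≤q⇒0≤q-p {p} {q} p≤q = subst (_≤ q - p) (+-inverseʳ p) (+-monoˡ-≤ (- p) p≤q)

affine-mono-≤ : ∀ c d {p q} .{{_ : Positive c}} → p ≤ q → c * p + d ≤ c * q + d
affine-mono-≤ c d p≤q = +-monoˡ-≤ d (*-monoˡ-≤-nonNeg c {{pos⇒nonNeg c}} p≤q)

affine-mono-< : ∀ c d {p q} .{{_ : Positive c}} → p < q → c * p + d < c * q + d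
affine-mono-< c d p<q = +-monoˡ-< d (*-monoʳ-<-pos c p<q)

i*n≤a<suc[j]*n⇒i≤j : ∀ {i j a} n → i ℤ.* + suc n ℤ.≤ a → a ℤ.< ℤ.suc j ℤ.* + suc n → i ℤ.≤ j
i*n≤a<suc[j]*n⇒i≤j n i*n≤a a<sj*n = ℤ.≮⇒≥ λ j<i →
  ℤ.<-irrefl refl (ℤ.<-≤-trans a<sj*n (ℤ.≤-trans (ℤ.*-monoʳ-≤-nonNeg (+ suc n) (ℤ.i<j⇒suc[i]≤j j<i)) i*n≤a))

/-unique : ∀ a z n → z ℤ.* + suc n ℤ.≤ a → a ℤ.< ℤ.suc z ℤ.* + suc n → a ℤ./ + suc n ≡ z
/-unique a z n z*n≤a a<sz*n = ℤ.≤-antisym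
  (i*n≤a<suc[j]*n⇒i≤j n q*n≤a a<sz*n) (i*n≤a<suc[j]*n⇒i≤j n z*n≤a a<suc[q]*n)
  where
  q r : ℤ
  q = a ℤ./ + suc n
  r = + (a ℤ.% + suc n)
  a≡r+q*n : a ≡ r ℤ.+ q ℤ.* + suc n
  a≡r+q*n = a≡a%n+[a/n]*n a (+ suc n)
  q*n≤a : q ℤ.* + suc n ℤ.≤ a
  q*n≤a = subst (q ℤ.* + suc n ℤ.≤_) (sym a≡r+q*n) (ℤ.i≤j+i (q ℤ.* + suc n) r)
  a<suc[q]*n : a ℤ.< ℤ.suc q ℤ.* + suc n
  a<suc[q]*n = subst₂ ℤ._<_ (sym a≡r+q*n) (sym (ℤ.suc-* q (+ suc n)))
                 (ℤ.+-monoˡ-< (q ℤ.* + suc n) (ℤ.+<+ (n%d<d a (+ suc n))))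

i/1≡fromℤ : ∀ i → i / 1 ≡ fromℤ i
i/1≡fromℤ (+ n)    = normalize-coprime {n} {0} _
i/1≡fromℤ -[1+ n ] = cong -_ (normalize-coprime {suc n} {0} _)

floor-unique : ∀ q z → z / 1 ≤ q → q < ℤ.suc z / 1 → floor q ≡ z
floor-unique (mkℚ a n _) z z≤q q<sz rewrite i/1≡fromℤ z | i/1≡fromℤ (ℤ.suc z) with z≤q | q<sz
... | *≤* z*n≤a | *<* a<sz*n = /-unique a z n (subst (z ℤ.* + suc n ℤ.≤_) (ℤ.*-identityʳ a) z*n≤a)
                                             (subst (ℤ._< ℤ.suc z ℤ.* + suc n) (ℤ.*-identityʳ a) a<sz*n)

fromℕ : ℕ → ℚ
fromℕ n = + n / 1

fromℕ-+ : ∀ a b → fromℕ (a ℕ.+ b) ≡ fromℕ a + fromℕ b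
fromℕ-+ a b = begin
  + (a ℕ.+ b) / 1                         ≡⟨ cong (_/ 1) (trans (ℤ.pos-+ a b) (sym (cong₂ ℤ._+_ (ℤ.*-identityʳ (+ a)) (ℤ.*-identityʳ (+ b))))) ⟩
  (+ a ℤ.* + 1 ℤ.+ + b ℤ.* + 1) / 1       ≡⟨ sym (cong₂ _+_ (i/1≡fromℤ (+ a)) (i/1≡fromℤ (+ b))) ⟩
  fromℕ a + fromℕ b                       ∎
  where open ≡-Reasoning

fromℕ-* : ∀ a b → fromℕ (a ℕ.* b) ≡ fromℕ a * fromℕ b
fromℕ-* a b = begin
  + (a ℕ.* b) / 1        ≡⟨ cong (_/ 1) (ℤ.pos-* a b) ⟩
  (+ a ℤ.* + b) / 1      ≡⟨ sym (cong₂ _*_ (i/1≡fromℤ (+ a)) (i/1≡fromℤ (+ b))) ⟩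
  fromℕ a * fromℕ b      ∎
  where open ≡-Reasoning

fromℕ-suc : ∀ e → fromℕ (suc e) ≡ fromℕ e + 1ℚ
fromℕ-suc e = trans (cong fromℕ (ℕ.+-comm 1 e)) (fromℕ-+ e 1)

suc[-[1+e]]/1≡-fromℕ : ∀ e → ℤ.suc -[1+ e ] / 1 ≡ - fromℕ e
suc[-[1+e]]/1≡-fromℕ zero    = refl
suc[-[1+e]]/1≡-fromℕ (suc e) = refl

ceiling≡-floor[-q] : ∀ q → ceiling q ≡ ℤ.- floor (- q)
ceiling≡-floor[-q] (mkℚ _ _ _) = refl

ceiling-fromℕ+ : ∀ e s → 0ℚ < s → s ≤ 1ℚ → ceiling (fromℕ e + s) ≡ + suc e
ceiling-fromℕ+ e s 0<s s≤1 = trans (ceiling≡-floor[-q] (fromℕ e + s)) (cong ℤ.-_ (floor-unique (- (fromℕ e + s)) -[1+ e ] lower upper))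
  where
  lower : - fromℕ (suc e) ≤ - (fromℕ e + s)
  lower = neg-antimono-≤ (subst (fromℕ e + s ≤_) (sym (fromℕ-suc e)) (+-monoʳ-≤ (fromℕ e) s≤1))
  upper : - (fromℕ e + s) < ℤ.suc -[1+ e ] / 1
  upper = subst (- (fromℕ e + s) <_) (sym (suc[-[1+e]]/1≡-fromℕ e))
            (neg-antimono-< (subst (_< fromℕ e + s) (+-identityʳ (fromℕ e)) (+-monoʳ-< (fromℕ e) 0<s)))

frac2-lower : ∀ {x} → 0ℚ ≤ x → x < ½ → frac2 x ≡ + 2 / 1 * x
frac2-lower {x} 0≤x x<½
  rewrite floor-unique (+ 2 / 1 * x) (+ 0) (*-monoˡ-≤-nonNeg (+ 2 / 1) 0≤x) (*-monoʳ-<-pos (+ 2 / 1) x<½)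
  = +-identityʳ (+ 2 / 1 * x)

frac2-upper : ∀ {x} → ½ ≤ x → x < 1ℚ → frac2 x ≡ + 2 / 1 * x - 1ℚ
frac2-upper {x} ½≤x x<1
  rewrite floor-unique (+ 2 / 1 * x) (+ 1) (*-monoˡ-≤-nonNeg (+ 2 / 1) ½≤x) (*-monoʳ-<-pos (+ 2 / 1) x<1)
  = refl

Δ₁-lower : ∀ {x} → x ≤ ½ → Δ 1 x ≡ x
Δ₁-lower {x} x≤½ = begin
  ½ - ∣ x - ½ ∣        ≡⟨ cong (λ t → ½ - ∣ t ∣) (solve 1 (λ x → x :- con ½ := :- (con ½ :- x)) refl x) ⟩
  ½ - ∣ - (½ - x) ∣    ≡⟨ cong (λ t → ½ - t) (∣-p∣≡∣p∣ (½ - x)) ⟩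
  ½ - ∣ ½ - x ∣        ≡⟨ cong (λ t → ½ - t) (0≤p⇒∣p∣≡p (p≤q⇒0≤q-p x≤½)) ⟩
  ½ - (½ - x)          ≡⟨ solve 1 (λ x → con ½ :- (con ½ :- x) := x) refl x ⟩
  x                    ∎
  where open ≡-Reasoning

Δ₁-upper : ∀ {x} → ½ ≤ x → Δ 1 x ≡ 1ℚ - x
Δ₁-upper {x} ½≤x = begin
  ½ - ∣ x - ½ ∣        ≡⟨ cong (λ t → ½ - t) (0≤p⇒∣p∣≡p (p≤q⇒0≤q-p ½≤x)) ⟩
  ½ - (x - ½)          ≡⟨ solve 1 (λ x → con ½ :- (x :- con ½) := con 1ℚ :- x) refl x ⟩
  1ℚ - x               ∎
  where open ≡-Reasoning

m-suc : ∀ n x → m (suc n) x ≡ Δ 1 x + ½ * m n (frac2 x)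
m-suc zero    x = solve 1 (λ d → con 0ℚ :+ d := d :+ con ½ :* con 0ℚ) refl (Δ 1 x)
m-suc (suc n) x = begin
  m (suc n) x + ½ * Δ (suc n) (frac2 x)                            ≡⟨ cong (_+ ½ * Δ (suc n) (frac2 x)) (m-suc n x) ⟩
  Δ 1 x + ½ * m n (frac2 x) + ½ * Δ (suc n) (frac2 x)              ≡⟨ solve 3 (λ d a b → d :+ con ½ :* a :+ con ½ :* b := d :+ con ½ :* (a :+ b))
                                                                        refl (Δ 1 x) (m n (frac2 x)) (Δ (suc n) (frac2 x)) ⟩
  Δ 1 x + ½ * (m n (frac2 x) + Δ (suc n) (frac2 x))                ∎
  where open ≡-Reasoning

m-suc-lower : ∀ n {x} → 0ℚ ≤ x → x < ½ → m (suc n) x ≡ x + ½ * m n (+ 2 / 1 * x)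
m-suc-lower n {x} 0≤x x<½ =
  trans (m-suc n x) (cong₂ (λ a b → a + ½ * m n b) (Δ₁-lower (<⇒≤ x<½)) (frac2-lower 0≤x x<½))

m-suc-upper : ∀ n {x} → ½ ≤ x → x < 1ℚ → m (suc n) x ≡ (1ℚ - x) + ½ * m n (+ 2 / 1 * x - 1ℚ)
m-suc-upper n {x} ½≤x x<1 =
  trans (m-suc n x) (cong₂ (λ a b → a + ½ * m n b) (Δ₁-upper ½≤x) (frac2-upper ½≤x x<1))

m-at-0 : ∀ n → m n 0ℚ ≡ 0ℚ
m-at-0 zero    = refl
m-at-0 (suc n) = trans (m-suc-lower n ≤-refl <-compute) (cong (λ t → 0ℚ + ½ * t) (m-at-0 n))

frac2-∈[0,1] : ∀ {x} → 0ℚ ≤ x → x ≤ 1ℚ → 0ℚ ≤ frac2 x × frac2 x ≤ 1ℚ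
frac2-∈[0,1] {x} 0≤x x≤1 with x <? ½ | x <? 1ℚ
... | yes x<½ | _ = subst (λ t → 0ℚ ≤ t × t ≤ 1ℚ) (sym (frac2-lower 0≤x x<½))
                     (*-monoˡ-≤-nonNeg (+ 2 / 1) 0≤x , <⇒≤ (*-monoʳ-<-pos (+ 2 / 1) x<½))
... | no x≮½ | yes x<1 = subst (λ t → 0ℚ ≤ t × t ≤ 1ℚ) (sym (frac2-upper (≮⇒≥ x≮½) x<1))
                          (affine-mono-≤ (+ 2 / 1) (- 1ℚ) (≮⇒≥ x≮½) , <⇒≤ (affine-mono-< (+ 2 / 1) (- 1ℚ) x<1))
... | no _   | no x≮1 = subst (λ t → 0ℚ ≤ frac2 t × frac2 t ≤ 1ℚ) (≤-antisym (≮⇒≥ x≮1) x≤1) (≤-compute , ≤-compute)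

Δ-nonNeg : ∀ k {x} → 0ℚ ≤ x → x ≤ 1ℚ → 0ℚ ≤ Δ k x
Δ-nonNeg zero          _   _   = ≤-refl
Δ-nonNeg (suc zero)    {x} 0≤x x≤1 with ≤-total x ½
... | inj₁ x≤½ = subst (0ℚ ≤_) (sym (Δ₁-lower x≤½)) 0≤x
... | inj₂ ½≤x = subst (0ℚ ≤_) (sym (Δ₁-upper ½≤x)) (p≤q⇒0≤q-p x≤1)
Δ-nonNeg (suc (suc k)) 0≤x x≤1 =
  let 0≤fx , fx≤1 = frac2-∈[0,1] 0≤x x≤1 in *-monoˡ-≤-nonNeg ½ (Δ-nonNeg (suc k) 0≤fx fx≤1)

m-mono : ∀ {x N n} → 0ℚ ≤ x → x ≤ 1ℚ → N ≤ℕ n → m N x ≤ m n x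
m-mono {x} 0≤x x≤1 N≤n = go (ℕ.≤⇒≤′ N≤n)
  where
  go : ∀ {N n} → N ≤′ n → m N x ≤ m n x
  go ≤′-refl               = ≤-refl
  go {N} {suc n} (≤′-step N≤n) = ≤-trans (go N≤n)
    (subst (_≤ m (suc n) x) (+-identityʳ (m n x)) (+-monoʳ-≤ (m n x) (Δ-nonNeg (suc n) 0≤x x≤1)))

m-prefix-01 : ∀ n {x} → + 1 / 4 ≤ x → x < ½ → m (2 ℕ.+ n) x ≡ ½ + + 1 / 4 * m n (+ 4 / 1 * x - 1ℚ)
m-prefix-01 n {x} ¼≤x x<½ = begin
  m (2 ℕ.+ n) x                                          ≡⟨ m-suc-lower (suc n) (≤-trans ≤-compute ¼≤x) x<½ ⟩
  x + ½ * m (suc n) (+ 2 / 1 * x)                        ≡⟨ cong (λ t → x + ½ * t) (m-suc-upper n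
                                                               (*-monoˡ-≤-nonNeg (+ 2 / 1) ¼≤x) (*-monoʳ-<-pos (+ 2 / 1) x<½)) ⟩
  x + ½ * (1ℚ - + 2 / 1 * x + ½ * m n (+ 2 / 1 * (+ 2 / 1 * x) - 1ℚ))
       ≡⟨ cong (λ t → x + ½ * (1ℚ - + 2 / 1 * x + ½ * m n t))
            (solve 1 (λ x → con (+ 2 / 1) :* (con (+ 2 / 1) :* x) :- con 1ℚ := con (+ 4 / 1) :* x :- con 1ℚ) refl x) ⟩
  x + ½ * (1ℚ - + 2 / 1 * x + ½ * m n (+ 4 / 1 * x - 1ℚ))
       ≡⟨ solve 2 (λ x t → x :+ con ½ :* (con 1ℚ :- con (+ 2 / 1) :* x :+ con ½ :* t) := con ½ :+ con (+ 1 / 4) :* t)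
            refl x (m n (+ 4 / 1 * x - 1ℚ)) ⟩
  ½ + + 1 / 4 * m n (+ 4 / 1 * x - 1ℚ)                   ∎
  where open ≡-Reasoning

m-prefix-11 : ∀ n {x} → + 3 / 4 ≤ x → x < 1ℚ → m (2 ℕ.+ n) x ≡ + 2 / 1 - + 2 / 1 * x + + 1 / 4 * m n (+ 4 / 1 * x - + 3 / 1)
m-prefix-11 n {x} ¾≤x x<1 = begin
  m (2 ℕ.+ n) x                                          ≡⟨ m-suc-upper (suc n) (≤-trans ≤-compute ¾≤x) x<1 ⟩
  1ℚ - x + ½ * m (suc n) (+ 2 / 1 * x - 1ℚ)              ≡⟨ cong (λ t → 1ℚ - x + ½ * t) (m-suc-upper n
                                                               (affine-mono-≤ (+ 2 / 1) (- 1ℚ) ¾≤x) (affine-mono-< (+ 2 / 1) (- 1ℚ) x<1)) ⟩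
  1ℚ - x + ½ * (1ℚ - y + ½ * m n (+ 2 / 1 * y - 1ℚ))
       ≡⟨ cong (λ t → 1ℚ - x + ½ * (1ℚ - y + ½ * m n t))
            (solve 1 (λ x → con (+ 2 / 1) :* (con (+ 2 / 1) :* x :- con 1ℚ) :- con 1ℚ := con (+ 4 / 1) :* x :- con (+ 3 / 1)) refl x) ⟩
  1ℚ - x + ½ * (1ℚ - y + ½ * m n (+ 4 / 1 * x - + 3 / 1))
       ≡⟨ solve 2 (λ x t → con 1ℚ :- x :+ con ½ :* (con 1ℚ :- (con (+ 2 / 1) :* x :- con 1ℚ) :+ con ½ :* t)
                          := con (+ 2 / 1) :- con (+ 2 / 1) :* x :+ con (+ 1 / 4) :* t)
            refl x (m n (+ 4 / 1 * x - + 3 / 1)) ⟩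
  + 2 / 1 - + 2 / 1 * x + + 1 / 4 * m n (+ 4 / 1 * x - + 3 / 1) ∎
  where
  open ≡-Reasoning
  y : ℚ
  y = + 2 / 1 * x - 1ℚ

m-prefix-0111 : ∀ n {x} → + 7 / 16 ≤ x → x < ½ →
  m (4 ℕ.+ n) x ≡ + 3 / 2 - + 2 / 1 * x + + 1 / 16 * m n (+ 16 / 1 * x - + 7 / 1)
m-prefix-0111 n {x} 7/16≤x x<½ = begin
  m (4 ℕ.+ n) x                                          ≡⟨ m-prefix-01 (2 ℕ.+ n) (≤-trans ≤-compute 7/16≤x) x<½ ⟩
  ½ + + 1 / 4 * m (2 ℕ.+ n) y                            ≡⟨ cong (λ t → ½ + + 1 / 4 * t) (m-prefix-11 n
                                                               (affine-mono-≤ (+ 4 / 1) (- 1ℚ) 7/16≤x) (affine-mono-< (+ 4 / 1) (- 1ℚ) x<½)) ⟩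
  ½ + + 1 / 4 * (+ 2 / 1 - + 2 / 1 * y + + 1 / 4 * m n (+ 4 / 1 * y - + 3 / 1))
       ≡⟨ cong (λ t → ½ + + 1 / 4 * (+ 2 / 1 - + 2 / 1 * y + + 1 / 4 * m n t))
            (solve 1 (λ x → con (+ 4 / 1) :* (con (+ 4 / 1) :* x :- con 1ℚ) :- con (+ 3 / 1) := con (+ 16 / 1) :* x :- con (+ 7 / 1)) refl x) ⟩
  ½ + + 1 / 4 * (+ 2 / 1 - + 2 / 1 * y + + 1 / 4 * m n (+ 16 / 1 * x - + 7 / 1))
       ≡⟨ solve 2 (λ x t → con ½ :+ con (+ 1 / 4) :* (con (+ 2 / 1) :- con (+ 2 / 1) :* (con (+ 4 / 1) :* x :- con 1ℚ) :+ con (+ 1 / 4) :* t)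
                          := con (+ 3 / 2) :- con (+ 2 / 1) :* x :+ con (+ 1 / 16) :* t)
            refl x (m n (+ 16 / 1 * x - + 7 / 1)) ⟩
  + 3 / 2 - + 2 / 1 * x + + 1 / 16 * m n (+ 16 / 1 * x - + 7 / 1) ∎
  where
  open ≡-Reasoning
  y : ℚ
  y = + 4 / 1 * x - 1ℚ

m-prefix-0111-five/eight : ∀ n {x} → + 7 / 16 ≤ x → x < ½ →
  m n (+ 16 / 1 * x - + 7 / 1) ≡ + 2 / 1 * (+ 16 / 1 * x - + 7 / 1) → m (4 ℕ.+ n) x ≡ five/eight
m-prefix-0111-five/eight n {x} 7/16≤x x<½ m≡2v = begin
  m (4 ℕ.+ n) x                                                         ≡⟨ m-prefix-0111 n 7/16≤x x<½ ⟩
  + 3 / 2 - + 2 / 1 * x + + 1 / 16 * m n (+ 16 / 1 * x - + 7 / 1)       ≡⟨ cong (λ t → + 3 / 2 - + 2 / 1 * x + + 1 / 16 * t) m≡2v ⟩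
  + 3 / 2 - + 2 / 1 * x + + 1 / 16 * (+ 2 / 1 * (+ 16 / 1 * x - + 7 / 1))
       ≡⟨ solve 1 (λ x → con (+ 3 / 2) :- con (+ 2 / 1) :* x :+ con (+ 1 / 16) :* (con (+ 2 / 1) :* (con (+ 16 / 1) :* x :- con (+ 7 / 1)))
                        := con five/eight) refl x ⟩
  five/eight                                                            ∎
  where open ≡-Reasoning

m₂-on-[0,¼] : ∀ {x} → 0ℚ ≤ x → x ≤ + 1 / 4 → m 2 x ≡ + 2 / 1 * x
m₂-on-[0,¼] {x} 0≤x x≤¼ = begin
  m 2 x                                 ≡⟨ m-suc-lower 1 0≤x (≤-<-trans x≤¼ <-compute) ⟩
  x + ½ * (0ℚ + Δ 1 (+ 2 / 1 * x))      ≡⟨ cong (λ t → x + ½ * (0ℚ + t)) (Δ₁-lower (*-monoˡ-≤-nonNeg (+ 2 / 1) x≤¼)) ⟩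
  x + ½ * (0ℚ + + 2 / 1 * x)            ≡⟨ solve 1 (λ x → x :+ con ½ :* (con 0ℚ :+ con (+ 2 / 1) :* x) := con (+ 2 / 1) :* x) refl x ⟩
  + 2 / 1 * x                           ∎
  where open ≡-Reasoning

-- w j is 0.(01)^j in binary, the truncation of ⅓ to 2j digits.
w : ℕ → ℚ
w j = + 1 / 3 - + 1 / 3 * halfPow (j ℕ.* 2)

w-suc : ∀ j → w (suc j) ≡ + 1 / 4 * w j + + 1 / 4
w-suc j = solve 1 (λ h → con (+ 1 / 3) :- con (+ 1 / 3) :* (con ½ :* (con ½ :* h))
                      := con (+ 1 / 4) :* (con (+ 1 / 3) :- con (+ 1 / 3) :* h) :+ con (+ 1 / 4)) refl (halfPow (j ℕ.* 2))

4*w[suc]-1≡w : ∀ j → + 4 / 1 * w (suc j) - 1ℚ ≡ w j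
4*w[suc]-1≡w j = trans (cong (λ t → + 4 / 1 * t - 1ℚ) (w-suc j))
                       (solve 1 (λ a → con (+ 4 / 1) :* (con (+ 1 / 4) :* a :+ con (+ 1 / 4)) :- con 1ℚ := a) refl (w j))

w-nonNeg : ∀ j → 0ℚ ≤ w j
w-nonNeg zero    = ≤-compute
w-nonNeg (suc j) = subst (0ℚ ≤_) (sym (w-suc j)) (≤-trans ≤-compute (affine-mono-≤ (+ 1 / 4) (+ 1 / 4) (w-nonNeg j)))

w≤⅓ : ∀ j → w j ≤ + 1 / 3
w≤⅓ zero    = ≤-compute
w≤⅓ (suc j) = subst (_≤ + 1 / 3) (sym (w-suc j)) (≤-trans (affine-mono-≤ (+ 1 / 4) (+ 1 / 4) (w≤⅓ j)) ≤-compute)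

¼≤w[suc] : ∀ j → + 1 / 4 ≤ w (suc j)
¼≤w[suc] j = subst (+ 1 / 4 ≤_) (sym (w-suc j)) (≤-trans ≤-compute (affine-mono-≤ (+ 1 / 4) (+ 1 / 4) (w-nonNeg j)))

w<½ : ∀ j → w j < ½
w<½ j = ≤-<-trans (w≤⅓ j) <-compute

m-between-w : ∀ j {x} → w j ≤ x → x ≤ w (suc j) → m (2 ℕ.+ j ℕ.* 2) x ≡ + 2 / 1 * x
m-between-w zero    w₀≤x x≤w₁ = m₂-on-[0,¼] w₀≤x x≤w₁
m-between-w (suc j) {x} w≤x x≤w = begin
  m (2 ℕ.+ (2 ℕ.+ j ℕ.* 2)) x                          ≡⟨ m-prefix-01 (2 ℕ.+ j ℕ.* 2) (≤-trans (¼≤w[suc] j) w≤x) (≤-<-trans x≤w (w<½ (suc (suc j)))) ⟩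
  ½ + + 1 / 4 * m (2 ℕ.+ j ℕ.* 2) (+ 4 / 1 * x - 1ℚ)    ≡⟨ cong (λ t → ½ + + 1 / 4 * t) (m-between-w j
                                                             (subst (_≤ + 4 / 1 * x - 1ℚ) (4*w[suc]-1≡w j) (affine-mono-≤ (+ 4 / 1) (- 1ℚ) w≤x))
                                                             (subst (+ 4 / 1 * x - 1ℚ ≤_) (4*w[suc]-1≡w (suc j)) (affine-mono-≤ (+ 4 / 1) (- 1ℚ) x≤w))) ⟩
  ½ + + 1 / 4 * (+ 2 / 1 * (+ 4 / 1 * x - 1ℚ))         ≡⟨ solve 1 (λ x → con ½ :+ con (+ 1 / 4) :* (con (+ 2 / 1) :* (con (+ 4 / 1) :* x :- con 1ℚ))
                                                                    := con (+ 2 / 1) :* x) refl x ⟩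
  + 2 / 1 * x                                          ∎
  where open ≡-Reasoning

m-at-w : ∀ j n → m (j ℕ.* 2 ℕ.+ n) (w j) ≡ + 2 / 1 * w j
m-at-w zero    n = m-at-0 n
m-at-w (suc j) n = begin
  m (2 ℕ.+ (j ℕ.* 2 ℕ.+ n)) (w (suc j))                      ≡⟨ m-prefix-01 (j ℕ.* 2 ℕ.+ n) (¼≤w[suc] j) (w<½ (suc j)) ⟩
  ½ + + 1 / 4 * m (j ℕ.* 2 ℕ.+ n) (+ 4 / 1 * w (suc j) - 1ℚ)  ≡⟨ cong (λ t → ½ + + 1 / 4 * m (j ℕ.* 2 ℕ.+ n) t) (4*w[suc]-1≡w j) ⟩
  ½ + + 1 / 4 * m (j ℕ.* 2 ℕ.+ n) (w j)                      ≡⟨ cong (λ t → ½ + + 1 / 4 * t) (m-at-w j n) ⟩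
  ½ + + 1 / 4 * (+ 2 / 1 * w j)                              ≡⟨ solve 1 (λ a → con ½ :+ con (+ 1 / 4) :* (con (+ 2 / 1) :* a)
                                                                          := con (+ 2 / 1) :* (con (+ 1 / 4) :* a :+ con (+ 1 / 4))) refl (w j) ⟩
  + 2 / 1 * (+ 1 / 4 * w j + + 1 / 4)                        ≡⟨ cong (+ 2 / 1 *_) (sym (w-suc j)) ⟩
  + 2 / 1 * w (suc j)                                        ∎
  where open ≡-Reasoning

-- The common value of p (4 + 2j) and p (5 + 2j); in binary 0.0111(01)^j.
p′ : ℕ → ℚ
p′ j = + 7 / 16 + + 1 / 16 * w j

16*p′-7≡w : ∀ j → + 16 / 1 * p′ j - + 7 / 1 ≡ w j
16*p′-7≡w j = solve 1 (λ a → con (+ 16 / 1) :* (con (+ 7 / 16) :+ con (+ 1 / 16) :* a) :- con (+ 7 / 1) := a) refl (w j)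

7/16≤p′ : ∀ j → + 7 / 16 ≤ p′ j
7/16≤p′ j = ≤-trans ≤-compute (+-monoʳ-≤ (+ 7 / 16) (*-monoˡ-≤-nonNeg (+ 1 / 16) (w-nonNeg j)))

p′<½ : ∀ j → p′ j < ½
p′<½ j = ≤-<-trans (+-monoʳ-≤ (+ 7 / 16) (*-monoˡ-≤-nonNeg (+ 1 / 16) (w≤⅓ j))) <-compute

m-at-p′ : ∀ j r → m (4 ℕ.+ j ℕ.* 2 ℕ.+ r) (p′ j) ≡ five/eight
m-at-p′ j r = m-prefix-0111-five/eight (j ℕ.* 2 ℕ.+ r) (7/16≤p′ j) (p′<½ j)
  (subst (λ v → m (j ℕ.* 2 ℕ.+ r) v ≡ + 2 / 1 * v) (sym (16*p′-7≡w j)) (m-at-w j r))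

m-between-p′ : ∀ j {x} → p′ j ≤ x → x ≤ p′ (suc j) → m (6 ℕ.+ j ℕ.* 2) x ≡ five/eight
m-between-p′ j {x} p′≤x x≤p′ = m-prefix-0111-five/eight (2 ℕ.+ j ℕ.* 2) (≤-trans (7/16≤p′ j) p′≤x) (≤-<-trans x≤p′ (p′<½ (suc j)))
  (m-between-w j (subst (_≤ v) (16*p′-7≡w j) (affine-mono-≤ (+ 16 / 1) (- (+ 7 / 1)) p′≤x))
                 (subst (v ≤_) (16*p′-7≡w (suc j)) (affine-mono-≤ (+ 16 / 1) (- (+ 7 / 1)) x≤p′)))
  where
  v : ℚ
  v = + 16 / 1 * x - + 7 / 1

fromℕ[2^N]*halfPow≡1 : ∀ N → fromℕ (2 ^ N) * halfPow N ≡ 1ℚ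
fromℕ[2^N]*halfPow≡1 zero    = refl
fromℕ[2^N]*halfPow≡1 (suc N) = begin
  fromℕ (2 ℕ.* 2 ^ N) * (½ * halfPow N)             ≡⟨ cong (_* (½ * halfPow N)) (fromℕ-* 2 (2 ^ N)) ⟩
  + 2 / 1 * fromℕ (2 ^ N) * (½ * halfPow N)         ≡⟨ solve 2 (λ a h → con (+ 2 / 1) :* a :* (con ½ :* h) := a :* h) refl (fromℕ (2 ^ N)) (halfPow N) ⟩
  fromℕ (2 ^ N) * halfPow N                         ≡⟨ fromℕ[2^N]*halfPow≡1 N ⟩
  1ℚ                                                ∎
  where open ≡-Reasoning

-- If 2^N = 24e + r with 0 < r ≤ 24 then ⌈2^N/24⌉ = e + 1, and e is eliminated using 2^N · 2^-N = 1.
p-residue : ∀ N e r → 2 ^ N ≡ 24 ℕ.* e ℕ.+ r → 0ℚ < fromℕ r * (+ 1 / 24) → fromℕ r * (+ 1 / 24) ≤ 1ℚ →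
  p N ≡ ½ - + 1 / 24 - (1ℚ - fromℕ r * (+ 1 / 24)) * halfPow N
p-residue N e r 2^N≡24e+r 0<r/24 r/24≤1 = begin
  ½ - (ceiling (fromℕ (2 ^ N) * (+ 1 / 24)) / 1) * h
       ≡⟨ cong (λ t → ½ - (ceiling t / 1) * h) 2^N/24≡e+r/24 ⟩
  ½ - (ceiling (fromℕ e + fromℕ r * (+ 1 / 24)) / 1) * h
       ≡⟨ cong (λ t → ½ - (t / 1) * h) (ceiling-fromℕ+ e (fromℕ r * (+ 1 / 24)) 0<r/24 r/24≤1) ⟩
  ½ - fromℕ (suc e) * h
       ≡⟨ cong (λ t → ½ - t * h) (fromℕ-suc e) ⟩
  ½ - (fromℕ e + 1ℚ) * h
       ≡⟨ solve 3 (λ E R h → con ½ :- (E :+ con 1ℚ) :* h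
                          := con ½ :- con (+ 1 / 24) :* ((con (+ 24 / 1) :* E :+ R) :* h) :- (con 1ℚ :- R :* con (+ 1 / 24)) :* h)
            refl (fromℕ e) (fromℕ r) h ⟩
  ½ - + 1 / 24 * ((+ 24 / 1 * fromℕ e + fromℕ r) * h) - (1ℚ - fromℕ r * (+ 1 / 24)) * h
       ≡⟨ cong (λ t → ½ - + 1 / 24 * t - (1ℚ - fromℕ r * (+ 1 / 24)) * h)
            (trans (cong (_* h) (sym 2^N≡24e+r′)) (fromℕ[2^N]*halfPow≡1 N)) ⟩
  ½ - + 1 / 24 - (1ℚ - fromℕ r * (+ 1 / 24)) * h      ∎
  where
  open ≡-Reasoning
  h = halfPow N
  2^N≡24e+r′ : fromℕ (2 ^ N) ≡ + 24 / 1 * fromℕ e + fromℕ r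
  2^N≡24e+r′ = trans (cong fromℕ 2^N≡24e+r) (trans (fromℕ-+ (24 ℕ.* e) r) (cong (_+ fromℕ r) (fromℕ-* 24 e)))
  2^N/24≡e+r/24 : fromℕ (2 ^ N) * (+ 1 / 24) ≡ fromℕ e + fromℕ r * (+ 1 / 24)
  2^N/24≡e+r/24 = trans (cong (_* (+ 1 / 24)) 2^N≡24e+r′)
    (solve 2 (λ E R → (con (+ 24 / 1) :* E :+ R) :* con (+ 1 / 24) := E :+ R :* con (+ 1 / 24)) refl (fromℕ e) (fromℕ r))

2^[4+2j]≡24e+16 : ∀ j → ∃ λ e → 2 ^ (4 ℕ.+ j ℕ.* 2) ≡ 24 ℕ.* e ℕ.+ 16
2^[4+2j]≡24e+16 zero = 0 , refl
2^[4+2j]≡24e+16 (suc j) with 2^[4+2j]≡24e+16 j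
... | e , 2^N≡24e+16 = 4 ℕ.* e ℕ.+ 2 , (begin
  2 ℕ.* (2 ℕ.* 2 ^ (4 ℕ.+ j ℕ.* 2))    ≡⟨ cong (λ t → 2 ℕ.* (2 ℕ.* t)) 2^N≡24e+16 ⟩
  2 ℕ.* (2 ℕ.* (24 ℕ.* e ℕ.+ 16))       ≡⟨ ℕ-Solver.solve (e ∷ []) ⟩
  24 ℕ.* (4 ℕ.* e ℕ.+ 2) ℕ.+ 16         ∎)
  where open ≡-Reasoning

halfPow-+ : ∀ a b → halfPow (a ℕ.+ b) ≡ halfPow a * halfPow b
halfPow-+ zero    b = sym (*-identityˡ (halfPow b))
halfPow-+ (suc a) b = trans (cong (½ *_) (halfPow-+ a b)) (sym (*-assoc ½ (halfPow a) (halfPow b)))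

p-even : ∀ j → p (4 ℕ.+ j ℕ.* 2) ≡ p′ j
p-even j =
  let e , 2^N≡24e+16 = 2^[4+2j]≡24e+16 j in begin
  p (4 ℕ.+ j ℕ.* 2)                                           ≡⟨ p-residue (4 ℕ.+ j ℕ.* 2) e 16 2^N≡24e+16 <-compute ≤-compute ⟩
  ½ - + 1 / 24 - c * halfPow (4 ℕ.+ j ℕ.* 2)                  ≡⟨ cong (λ h → ½ - + 1 / 24 - c * h) (halfPow-+ 4 (j ℕ.* 2)) ⟩
  ½ - + 1 / 24 - c * (halfPow 4 * halfPow (j ℕ.* 2))          ≡⟨ solve 1 (λ h → con ½ :- con (+ 1 / 24) :- con c :* (con (halfPow 4) :* h)
                                                                       := con (+ 7 / 16) :+ con (+ 1 / 16) :* (con (+ 1 / 3) :- con (+ 1 / 3) :* h))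
                                                                   refl (halfPow (j ℕ.* 2)) ⟩
  p′ j                                                        ∎
  where
  open ≡-Reasoning
  c : ℚ
  c = 1ℚ - fromℕ 16 * (+ 1 / 24)

p-odd : ∀ j → p (5 ℕ.+ j ℕ.* 2) ≡ p′ j
p-odd j =
  let e , 2^N≡24e+16 = 2^[4+2j]≡24e+16 j in begin
  p (5 ℕ.+ j ℕ.* 2)                                           ≡⟨ p-residue (5 ℕ.+ j ℕ.* 2) (2 ℕ.* e ℕ.+ 1) 8 (2^N≡24e′+8 e 2^N≡24e+16) <-compute ≤-compute ⟩
  ½ - + 1 / 24 - c * halfPow (5 ℕ.+ j ℕ.* 2)                  ≡⟨ cong (λ h → ½ - + 1 / 24 - c * h) (halfPow-+ 5 (j ℕ.* 2)) ⟩
  ½ - + 1 / 24 - c * (halfPow 5 * halfPow (j ℕ.* 2))          ≡⟨ solve 1 (λ h → con ½ :- con (+ 1 / 24) :- con c :* (con (halfPow 5) :* h)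
                                                                       := con (+ 7 / 16) :+ con (+ 1 / 16) :* (con (+ 1 / 3) :- con (+ 1 / 3) :* h))
                                                                   refl (halfPow (j ℕ.* 2)) ⟩
  p′ j                                                        ∎
  where
  open ≡-Reasoning
  c : ℚ
  c = 1ℚ - fromℕ 8 * (+ 1 / 24)
  2^N≡24e′+8 : ∀ e → 2 ^ (4 ℕ.+ j ℕ.* 2) ≡ 24 ℕ.* e ℕ.+ 16 → 2 ^ (5 ℕ.+ j ℕ.* 2) ≡ 24 ℕ.* (2 ℕ.* e ℕ.+ 1) ℕ.+ 8
  2^N≡24e′+8 e 2^N≡24e+16 = begin
    2 ℕ.* 2 ^ (4 ℕ.+ j ℕ.* 2)           ≡⟨ cong (2 ℕ.*_) 2^N≡24e+16 ⟩
    2 ℕ.* (24 ℕ.* e ℕ.+ 16)             ≡⟨ ℕ-Solver.solve (e ∷ []) ⟩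
    24 ℕ.* (2 ℕ.* e ℕ.+ 1) ℕ.+ 8        ∎

parity : ∀ k → ∃ λ j → k ≡ j ℕ.* 2 ⊎ k ≡ suc (j ℕ.* 2)
parity zero    = 0 , inj₁ refl
parity (suc k) with parity k
... | j , inj₁ refl = j , inj₂ refl
... | j , inj₂ refl = suc j , inj₁ refl

m-at-p : ∀ {k} r → (∃ λ j → k ≡ j ℕ.* 2 ⊎ k ≡ suc (j ℕ.* 2)) → m (4 ℕ.+ k ℕ.+ r) (p (4 ℕ.+ k)) ≡ five/eight
m-at-p r (j , inj₁ refl) = trans (cong (m (4 ℕ.+ j ℕ.* 2 ℕ.+ r)) (p-even j)) (m-at-p′ j r)
m-at-p r (j , inj₂ refl) = trans (cong₂ m (cong (4 ℕ.+_) (sym (ℕ.+-suc (j ℕ.* 2) r))) (p-odd j)) (m-at-p′ j (suc r))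

m-between-p : ∀ j n → 6 ℕ.+ j ℕ.* 2 ≤ℕ n → ∀ x → p (4 ℕ.+ j ℕ.* 2) ≤ x → x ≤ p (6 ℕ.+ j ℕ.* 2) →
  (m (6 ℕ.+ j ℕ.* 2) x ≡ five/eight) × (m (6 ℕ.+ j ℕ.* 2) x ≤ m n x)
m-between-p j n N≤n x p≤x x≤p = m-between-p′ j p′≤x x≤p′ , m-mono 0≤x x≤1 N≤n
  where
  p′≤x : p′ j ≤ x
  p′≤x = subst (_≤ x) (p-even j) p≤x
  x≤p′ : x ≤ p′ (suc j)
  x≤p′ = subst (x ≤_) (p-even (suc j)) x≤p
  0≤x : 0ℚ ≤ x
  0≤x = ≤-trans (≤-trans ≤-compute (7/16≤p′ j)) p′≤x
  x≤1 : x ≤ 1ℚ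
  x≤1 = <⇒≤ (≤-<-trans x≤p′ (<-trans (p′<½ (suc j)) <-compute))

lemma4p6 : ((N n : ℕ) → 4 ≤ℕ N → N ≤ℕ n → m n (p N) ≡ five/eight)
           × ((N : ℕ) → 2 ∣ N → 6 ≤ℕ N → (n : ℕ) → N ≤ℕ n → (x : ℚ)
              → p (N ∸ 2) ≤ x → x ≤ p N
              → (m N x ≡ five/eight) × (m N x ≤ m n x))
lemma4p6 = part-a , part-b
  where
  part-a : (N n : ℕ) → 4 ≤ℕ N → N ≤ℕ n → m n (p N) ≡ five/eight
  part-a N n 4≤N N≤n with ℕ.m≤n⇒∃[o]m+o≡n 4≤N | ℕ.m≤n⇒∃[o]m+o≡n N≤n
  ... | k , refl | r , refl = m-at-p r (parity k)

  part-b : (N : ℕ) → 2 ∣ N → 6 ≤ℕ N → (n : ℕ) → N ≤ℕ n → (x : ℚ) → p (N ∸ 2) ≤ x → x ≤ p N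
           → (m N x ≡ five/eight) × (m N x ≤ m n x)
  part-b _ (divides 0 refl) ()
  part-b _ (divides 1 refl) (s≤s (s≤s ()))
  part-b _ (divides 2 refl) (s≤s (s≤s (s≤s (s≤s ()))))
  part-b _ (divides (suc (suc (suc j))) refl) _ = m-between-p j
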